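{- Let $x\ge1$ and $y,z\in\mathbb{Z}_{\ge1}$ with $y\ne z$. Then the $(1,x,y,z)$-hiccup sequence is morphic. If moreover $x=1$ and $y>1$, it is purely morphic.
   Context: The $(1,x,y,z)$-hiccup sequence is the integer sequence $(a(n))_{n\ge1}$ defined by $a(1)=x$ and, for $n\ge 2$, $a(n)=a(n-1)+y$ if $n-1\in\{a(k):1\le k<n\}$, and $a(n)=a(n-1)+z$ otherwise. The characteristic sequence of an increasing integer sequence $(a(n))$ is the binary sequence $(c(m))_{m\ge1}$ with $c(m)=1$ if $m=a(k)$ for some $k$ and $c(m)=0$ otherwise. A binary sequence $(c(m))_{m\ge1}$ is morphic if there exist a finite alphabet $\Sigma$, a morphism $\phi:\Sigma\to\Sigma^*$, a letter $s\in\Sigma$ such that $\phi(s)$ begins with $s$ and the lengths of $\phi^n(s)$ are unbounded (so $w=\phi^\infty(s)=w_1w_2\cdots$ is an infinite fixed point of $\phi$), and a letter-to-letter coding $\pi:\Sigma\to\{0,1\}$ with $c(m)=\pi(w_m)$ for all $m$; it is purely morphic if this is possible with $\Sigma=\{0,1\}$ and $\pi$ the identity. An increasing sequence is (purely) morphic if its characteristic sequence is. -}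

module Defs where

open import Data.Nat using (ℕ; zero; suc; _+_; _≤_; _<_)
open import Data.Nat.Properties using (_≟_)
open import Data.Bool using (Bool; true; false; if_then_else_)
open import Data.Fin using (Fin; fromℕ<)
open import Data.List using (List; []; _∷_; length; lookup; concatMap)
open import Data.List.Membership.DecPropositional _≟_ using (_∈?_)
open import Data.Product using (Σ; ∃; ∃-syntax; _×_; _,_; proj₁)
open import Relation.Nullary using (does)
open import Relation.Binary.PropositionalEquality using (_≡_)
open import Function.Bundles using (_⇔_)

-- The (1,x,y,z)-hiccup sequence.
-- hiccupAux x y z n = (a(n+1) , [a(n+1), a(n), ..., a(1)])
hiccupAux : ℕ → ℕ → ℕ → ℕ → ℕ × List ℕ
hiccupAux x y z zero = x , x ∷ []
hiccupAux x y z (suc n) with hiccupAux x y z n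
... | v , l =
  -- new index is N = n+2, so N-1 = suc n; l = {a(k) : 1 ≤ k < N}
  let v' = if does (suc n ∈? l) then v + y else v + z
  in v' , v' ∷ l

-- 0-indexed: hiccup x y z k = a(k+1)
hiccup : ℕ → ℕ → ℕ → ℕ → ℕ
hiccup x y z k = proj₁ (hiccupAux x y z k)

-- Characteristic sequence (0-indexed: c m = c(m+1)) of a 0-indexed
-- sequence a (a k = a(k+1)): c(m) = 1 iff m = a(k) for some k.
IsCharSeq : (ℕ → ℕ) → (ℕ → Bool) → Set
IsCharSeq a c = ∀ m → (c m ≡ true) ⇔ (∃[ k ] a k ≡ suc m)

extend : {A : Set} → (A → List A) → List A → List A
extend φ w = concatMap φ w

iter : {A : Set} → (A → List A) → ℕ → List A → List A
iter φ zero w = w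
iter φ (suc n) w = extend φ (iter φ n w)

-- w (0-indexed, w i = w_{i+1}) is the infinite fixed point φ^∞(s):
-- φ(s) begins with s, |φ^n(s)| unbounded, every φ^n(s) is a prefix of w.
IsFixedPointFrom : {A : Set} → (A → List A) → A → (ℕ → A) → Set
IsFixedPointFrom φ s w =
  (∃[ r ] φ s ≡ s ∷ r)
  × (∀ N → ∃[ n ] N ≤ length (iter φ n (s ∷ [])))
  × (∀ n i (p : i < length (iter φ n (s ∷ [])))
       → lookup (iter φ n (s ∷ [])) (fromℕ< p) ≡ w i)

-- Morphic binary sequence (finite alphabet Σ represented as Fin k).
Morphic : (ℕ → Bool) → Set
Morphic c =
  ∃[ k ] Σ (Fin k → List (Fin k)) λ φ → Σ (Fin k) λ s →
  Σ (ℕ → Fin k) λ w → Σ (Fin k → Bool) λ π →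
    IsFixedPointFrom φ s w × (∀ m → c m ≡ π (w m))

-- Purely morphic: alphabet {0,1} = Bool, coding the identity.
PurelyMorphic : (ℕ → Bool) → Set
PurelyMorphic c =
  Σ (Bool → List Bool) λ φ → Σ Bool λ s → Σ (ℕ → Bool) λ w →
    IsFixedPointFrom φ s w × (∀ m → c m ≡ w m)

MorphicSeq : (ℕ → ℕ) → Set
MorphicSeq a = ∃[ c ] IsCharSeq a c × Morphic c

PurelyMorphicSeq : (ℕ → ℕ) → Set
PurelyMorphicSeq a = ∃[ c ] IsCharSeq a c × PurelyMorphic c

module Submission where

open import Defs
open import Data.Nat
  using (ℕ; zero; suc; _+_; pred; _≤_; _<_; z≤n; s≤s; _≤′_; ≤′-refl; ≤′-step; _≤?_)
open import Data.Nat.Properties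
open import Data.Bool using (Bool; true; false; if_then_else_)
open import Data.Fin using (Fin; fromℕ<)
import Data.Fin as Fin
open import Data.List using (List; []; _∷_; [_]; _++_; length; lookup; replicate; map)
open import Data.List.Properties using (++-identityʳ; concatMap-++; map-++; map-replicate)
open import Data.List.Membership.DecPropositional _≟_ using (_∈?_; _∈_)
open import Data.List.Relation.Unary.Any using (here; there)
open import Data.Product using (_×_; _,_; ∃-syntax; proj₂)
open import Data.Sum using (inj₁; inj₂)
open import Data.Empty using (⊥-elim)
open import Function using (_∘_)
open import Function.Bundles using (mk⇔; Equivalence)
open import Relation.Nullary using (does; yes; no)
open import Relation.Binary.PropositionalEquality
  using (_≡_; _≢_; refl; sym; trans; cong; cong₂; subst; module ≡-Reasoning)

-- Let c be the characteristic word of a(1) < a(2) < ⋯. Since a(j+1) − a(j) is y or z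
-- according to whether c(j) is 1 or 0, the factor c(a(j)+1) ⋯ c(a(j+1)) is 0^d 1 with
-- d + 1 = a(j+1) − a(j), a block determined by the letter c(j). So b ↦ 0^d(b) 1 maps
-- c(2) ⋯ c(ℓ) onto c(a(2)+1) ⋯ c(a(ℓ+1)); renaming c(1) into a fresh letter with image
-- c(1) ⋯ c(a(2)) turns c into the coding of a fixed point. When x = 1 the blocks can
-- instead be read as c(a(j)) ⋯ c(a(j+1)−1) = 1 0^d, which cover c from its first
-- letter, so c itself is the fixed point of b ↦ 1 0^d(b); it grows because y > 1.

slice : {A : Set} → (ℕ → A) → ℕ → ℕ → List A
slice W m zero = []
slice W m (suc k) = W m ∷ slice W (suc m) k

module _ {A : Set} (W : ℕ → A) where

  length-slice : ∀ m k → length (slice W m k) ≡ k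
  length-slice m zero = refl
  length-slice m (suc k) = cong suc (length-slice (suc m) k)

  slice-++ : ∀ m i j → slice W m (i + j) ≡ slice W m i ++ slice W (m + i) j
  slice-++ m zero j = cong (λ n → slice W n j) (sym (+-identityʳ m))
  slice-++ m (suc i) j = cong (W m ∷_)
    (trans (slice-++ (suc m) i j) (cong (λ n → slice W (suc m) i ++ slice W n j) (sym (+-suc m i))))

  slice-∷ʳ : ∀ m k → slice W m (suc k) ≡ slice W m k ++ [ W (m + k) ]
  slice-∷ʳ m k = trans (cong (slice W m) (+-comm 1 k)) (slice-++ m k 1)

  lookup-slice : ∀ m k i (p : i < length (slice W m k)) → lookup (slice W m k) (fromℕ< p) ≡ W (m + i)
  lookup-slice m (suc k) zero p = cong W (sym (+-identityʳ m))
  lookup-slice m (suc k) (suc i) p = trans (lookup-slice (suc m) k i (≤-pred p)) (cong W (sym (+-suc m i)))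

  slice-replicate : ∀ m k u → (∀ t → t < k → W (m + t) ≡ u) → slice W m k ≡ replicate k u
  slice-replicate m zero u _ = refl
  slice-replicate m (suc k) u constant = cong₂ _∷_
    (trans (cong W (sym (+-identityʳ m))) (constant 0 (s≤s z≤n)))
    (slice-replicate (suc m) k u λ t t<k → trans (cong W (sym (+-suc m t))) (constant (suc t) (s≤s t<k)))

  slice-suc : ∀ m k → slice W (suc m) k ≡ slice (W ∘ suc) m k
  slice-suc m zero = refl
  slice-suc m (suc k) = cong (W (suc m) ∷_) (slice-suc (suc m) k)

slice-map : {A B : Set} (f : A → B) (W : ℕ → A) → ∀ m k → slice (f ∘ W) m k ≡ map f (slice W m k)
slice-map f W m zero = refl
slice-map f W m (suc k) = cong (f (W m) ∷_) (slice-map f W (suc m) k)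

extend-slice-∷ʳ : {A : Set} (φ : A → List A) (W : ℕ → A) → ∀ m k →
                  extend φ (slice W m (suc k)) ≡ extend φ (slice W m k) ++ φ (W (m + k))
extend-slice-∷ʳ φ W m k = begin
  extend φ (slice W m (suc k))                    ≡⟨ cong (extend φ) (slice-∷ʳ W m k) ⟩
  extend φ (slice W m k ++ [ W (m + k) ])         ≡⟨ concatMap-++ φ (slice W m k) [ W (m + k) ] ⟩
  extend φ (slice W m k) ++ (φ (W (m + k)) ++ []) ≡⟨ cong (extend φ (slice W m k) ++_) (++-identityʳ _) ⟩
  extend φ (slice W m k) ++ φ (W (m + k))         ∎
  where open ≡-Reasoning

module _ {A : Set} (φ : A → List A) (W : ℕ → A) (E : ℕ → ℕ)
         (expand : ∀ {ℓ} → 1 ≤ ℓ → extend φ (slice W 0 ℓ) ≡ slice W 0 (E ℓ))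
         (grow : ∀ {ℓ} → 1 ≤ ℓ → ℓ < E ℓ) where

  private
    prefixLength : ℕ → ℕ
    prefixLength zero = 1
    prefixLength (suc n) = E (prefixLength n)

    n<prefixLength : ∀ n → n < prefixLength n
    n<prefixLength zero = s≤s z≤n
    n<prefixLength (suc n) = ≤-<-trans (n<prefixLength n) (grow (≤-trans (s≤s z≤n) (n<prefixLength n)))

    iter-slice : ∀ n → iter φ n [ W 0 ] ≡ slice W 0 (prefixLength n)
    iter-slice zero = refl
    iter-slice (suc n) = trans (cong (extend φ) (iter-slice n)) (expand (≤-trans (s≤s z≤n) (n<prefixLength n)))

    slice-head : ∀ {k} → 1 ≤ k → ∃[ r ] slice W 0 k ≡ W 0 ∷ r
    slice-head (s≤s _) = _ , refl

    φ-head : ∃[ r ] φ (W 0) ≡ W 0 ∷ r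
    φ-head with slice-head (<⇒≤ (grow (s≤s z≤n)))
    ... | r , eq = r , trans (sym (++-identityʳ (φ (W 0)))) (trans (expand (s≤s z≤n)) eq)

    length-iter : ∀ n → length (iter φ n [ W 0 ]) ≡ prefixLength n
    length-iter n = trans (cong length (iter-slice n)) (length-slice W 0 (prefixLength n))

    lookup-≡slice : ∀ {xs} k → xs ≡ slice W 0 k → ∀ i (p : i < length xs) → lookup xs (fromℕ< p) ≡ W i
    lookup-≡slice k refl = lookup-slice W 0 k

  isFixedPointFrom-expanding : IsFixedPointFrom φ (W 0) W
  isFixedPointFrom-expanding =
      φ-head
    , (λ N → N , subst (N ≤_) (sym (length-iter N)) (<⇒≤ (n<prefixLength N)))
    , (λ n → lookup-≡slice (prefixLength n) (iter-slice n))

module StrictlyIncreasing {a : ℕ → ℕ} (a-increasing : ∀ n → a n < a (suc n)) where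

  monotone : ∀ {i j} → i ≤ j → a i ≤ a j
  monotone = go ∘ ≤⇒≤′
    where
    go : ∀ {i j} → i ≤′ j → a i ≤ a j
    go ≤′-refl = ≤-refl
    go (≤′-step i≤j) = ≤-trans (go i≤j) (<⇒≤ (a-increasing _))

  +-≤ : ∀ i k → a i + k ≤ a (i + k)
  +-≤ i zero = ≤-reflexive (trans (+-identityʳ (a i)) (cong a (sym (+-identityʳ i))))
  +-≤ i (suc k) = begin
    a i + suc k     ≡⟨ +-suc (a i) k ⟩
    suc (a i + k)   ≤⟨ s≤s (+-≤ i k) ⟩
    suc (a (i + k)) ≤⟨ a-increasing (i + k) ⟩
    a (suc (i + k)) ≡⟨ cong a (sym (+-suc i k)) ⟩
    a (i + suc k)   ∎
    where open ≤-Reasoning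

  skips : ∀ j {n} → a j < n → n < a (suc j) → ∀ k → a k ≢ n
  skips j after before k refl with k ≤? j
  ... | yes k≤j = <-irrefl refl (≤-<-trans (monotone k≤j) after)
  ... | no k≰j = <-irrefl refl (<-≤-trans before (monotone (≰⇒> k≰j)))

  module _ {c : ℕ → Bool} (isCharSeq : IsCharSeq a c) where

    value⇒true : ∀ {k m} → a k ≡ suc m → c m ≡ true
    value⇒true eq = Equivalence.from (isCharSeq _) (_ , eq)

    nonvalue⇒false : ∀ {m} → (∀ k → a k ≢ suc m) → c m ≡ false
    nonvalue⇒false {m} notValue with c m in eq
    ... | false = refl
    ... | true = ⊥-elim (let k , ak≡ = Equivalence.to (isCharSeq m) eq in notValue k ak≡)

    slice-gap : ∀ j d → a (suc j) ≡ a j + suc d → slice c (a j) d ≡ replicate d false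
    slice-gap j d gap = slice-replicate c (a j) d false λ t t<d →
      nonvalue⇒false (skips j (s≤s (m≤m+n (a j) t)) (before t<d))
      where
      before : ∀ {t} → t < d → suc (a j + t) < a (suc j)
      before {t} t<d = begin-strict
        suc (a j + t)   ≡⟨ +-suc (a j) t ⟨
        a j + suc t     <⟨ +-monoʳ-< (a j) (s≤s t<d) ⟩
        a j + suc d     ≡⟨ gap ⟨
        a (suc j)       ∎
        where open ≤-Reasoning

module Hiccup (x′ y′ z′ : ℕ) where

  x y z : ℕ
  x = suc x′
  y = suc y′
  z = suc z′

  a : ℕ → ℕ
  a = hiccup x y z

  history : ℕ → List ℕ
  history n = proj₂ (hiccupAux x y z n)

  c : ℕ → Bool
  c m = does (suc m ∈? history m)

  padding : Bool → ℕ
  padding b = if b then y′ else z′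

  a-suc : ∀ n → a (suc n) ≡ a n + suc (padding (c n))
  a-suc n with hiccupAux x y z n
  ... | v , l with does (suc n ∈? l)
  ...   | true = refl
  ...   | false = refl

  history-suc : ∀ n → history (suc n) ≡ a (suc n) ∷ history n
  history-suc n with hiccupAux x y z n
  ... | v , l = refl

  a-increasing : ∀ n → a n < a (suc n)
  a-increasing n = subst (a n <_) (sym (a-suc n)) (m<m+n (a n) (s≤s z≤n))

  open StrictlyIncreasing a-increasing public

  n<a : ∀ n → n < a n
  n<a n = ≤-trans (s≤s (m≤n+m n x′)) (+-≤ 0 n)

  a≡suc-pred : ∀ n → a n ≡ suc (pred (a n))
  a≡suc-pred n with a n | n<a n
  ... | suc _ | _ = refl

  ∈history⇒value : ∀ {m} n → m ∈ history n → ∃[ k ] a k ≡ m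
  ∈history⇒value zero (here eq) = 0 , sym eq
  ∈history⇒value {m} (suc n) m∈ with subst (m ∈_) (history-suc n) m∈
  ... | here eq = suc n , sym eq
  ... | there m∈′ = ∈history⇒value n m∈′

  value∈history : ∀ {k} n → k ≤ n → a k ∈ history n
  value∈history zero z≤n = here refl
  value∈history {k} (suc n) k≤ with m≤n⇒m<n∨m≡n k≤
  ... | inj₁ k<n = subst (a k ∈_) (sym (history-suc n)) (there (value∈history n (≤-pred k<n)))
  ... | inj₂ refl = subst (a k ∈_) (sym (history-suc n)) (here refl)

  isCharSeq : IsCharSeq a c
  isCharSeq m = mk⇔ to from
    where
    to : c m ≡ true → ∃[ k ] a k ≡ suc m
    to _ with suc m ∈? history m
    to _ | yes m∈ = ∈history⇒value m m∈
    to () | no _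

    -- a value suc m = a k has k ≤ m, so it is already recorded in history m
    from : ∃[ k ] a k ≡ suc m → c m ≡ true
    from (k , eq) with suc m ∈? history m
    ... | yes _ = refl
    ... | no ∉ = ⊥-elim (∉ (subst (_∈ history m) eq (value∈history m k≤m)))
      where
      k≤m : k ≤ m
      k≤m = ≤-pred (subst (suc k ≤_) eq (n<a k))

  start zero′ one′ : Fin 3
  start = Fin.zero
  zero′ = Fin.suc Fin.zero
  one′ = Fin.suc (Fin.suc Fin.zero)

  letter : Bool → Fin 3
  letter false = zero′
  letter true = one′

  W : ℕ → Fin 3
  W zero = start
  W (suc m) = letter (c (suc m))

  φ : Fin 3 → List (Fin 3)
  φ Fin.zero = slice W 0 (a 1)
  φ (Fin.suc Fin.zero) = replicate z′ zero′ ++ [ one′ ]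
  φ (Fin.suc (Fin.suc Fin.zero)) = replicate y′ zero′ ++ [ one′ ]

  π : Fin 3 → Bool
  π Fin.zero = c 0
  π (Fin.suc Fin.zero) = false
  π (Fin.suc (Fin.suc Fin.zero)) = true

  φ-letter : ∀ b → φ (letter b) ≡ replicate (padding b) zero′ ++ [ one′ ]
  φ-letter false = refl
  φ-letter true = refl

  π-letter : ∀ b → π (letter b) ≡ b
  π-letter false = refl
  π-letter true = refl

  c≡π∘W : ∀ m → c m ≡ π (W m)
  c≡π∘W zero = refl
  c≡π∘W (suc m) = sym (π-letter (c (suc m)))

  slice-W : ∀ {m} k → 1 ≤ m → slice W m k ≡ map letter (slice c m k)
  slice-W {suc m} k _ = begin
    slice W (suc m) k                  ≡⟨ slice-suc W m k ⟩
    slice (letter ∘ c ∘ suc) m k       ≡⟨ slice-map letter (c ∘ suc) m k ⟩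
    map letter (slice (c ∘ suc) m k)   ≡⟨ cong (map letter) (slice-suc c m k) ⟨
    map letter (slice c (suc m) k)     ∎
    where open ≡-Reasoning

  slice-W-gap : ∀ j → slice W (a j) (suc (padding (c j))) ≡ φ (letter (c j))
  slice-W-gap j = begin
    slice W (a j) (suc d)                           ≡⟨ slice-W (suc d) (≤-trans (s≤s z≤n) (n<a j)) ⟩
    map letter (slice c (a j) (suc d))              ≡⟨ cong (map letter) (slice-∷ʳ c (a j) d) ⟩
    map letter (slice c (a j) d ++ [ c (a j + d) ]) ≡⟨ cong (map letter) (cong₂ _++_ zeros (cong [_] one)) ⟩
    map letter (replicate d false ++ [ true ])      ≡⟨ map-++ letter (replicate d false) [ true ] ⟩
    map letter (replicate d false) ++ [ one′ ]      ≡⟨ cong (_++ [ one′ ]) (map-replicate letter d false) ⟩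
    replicate d zero′ ++ [ one′ ]                   ≡⟨ φ-letter (c j) ⟨
    φ (letter (c j))                                ∎
    where
    open ≡-Reasoning
    d = padding (c j)
    zeros : slice c (a j) d ≡ replicate d false
    zeros = slice-gap isCharSeq j d (a-suc j)
    one : c (a j + d) ≡ true
    one = value⇒true isCharSeq {suc j} (trans (a-suc j) (+-suc (a j) d))

  extend-slice-W : ∀ ℓ → extend φ (slice W 0 (suc ℓ)) ≡ slice W 0 (a (suc ℓ))
  extend-slice-W zero = ++-identityʳ (φ start)
  extend-slice-W (suc ℓ) = begin
    extend φ (slice W 0 (suc (suc ℓ)))                   ≡⟨ extend-slice-∷ʳ φ W 0 (suc ℓ) ⟩
    extend φ (slice W 0 (suc ℓ)) ++ φ (W (suc ℓ))        ≡⟨ cong (_++ φ (W (suc ℓ))) (extend-slice-W ℓ) ⟩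
    slice W 0 (a (suc ℓ)) ++ φ (letter (c (suc ℓ)))      ≡⟨ cong (slice W 0 (a (suc ℓ)) ++_) (slice-W-gap (suc ℓ)) ⟨
    slice W 0 (a (suc ℓ)) ++ slice W (a (suc ℓ)) (suc d) ≡⟨ slice-++ W 0 (a (suc ℓ)) (suc d) ⟨
    slice W 0 (a (suc ℓ) + suc d)                        ≡⟨ cong (slice W 0) (a-suc (suc ℓ)) ⟨
    slice W 0 (a (suc (suc ℓ)))                          ∎
    where
    open ≡-Reasoning
    d = padding (c (suc ℓ))

  morphic : MorphicSeq a
  morphic = c , isCharSeq , 3 , φ , start , W , π
          , isFixedPointFrom-expanding φ W a (λ { {suc ℓ} _ → extend-slice-W ℓ }) (λ {ℓ} _ → n<a ℓ)
          , c≡π∘W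

module HiccupFromOne (y″ z′ : ℕ) where

  open Hiccup 0 (suc y″) z′

  ψ : Bool → List Bool
  ψ b = true ∷ replicate (padding b) false

  slice-c-gap : ∀ ℓ {q} → a ℓ ≡ suc q → slice c q (suc (padding (c ℓ))) ≡ ψ (c ℓ)
  slice-c-gap ℓ eq = cong₂ _∷_ (value⇒true isCharSeq {ℓ} eq)
    (subst (λ m → slice c m d ≡ replicate d false) eq (slice-gap isCharSeq ℓ d (a-suc ℓ)))
    where d = padding (c ℓ)

  extend-slice-c : ∀ ℓ → extend ψ (slice c 0 ℓ) ≡ slice c 0 (pred (a ℓ))
  extend-slice-c zero = refl
  extend-slice-c (suc ℓ) = begin
    extend ψ (slice c 0 (suc ℓ))     ≡⟨ extend-slice-∷ʳ ψ c 0 ℓ ⟩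
    extend ψ (slice c 0 ℓ) ++ ψ (c ℓ) ≡⟨ cong (_++ ψ (c ℓ)) (extend-slice-c ℓ) ⟩
    slice c 0 q ++ ψ (c ℓ)           ≡⟨ cong (slice c 0 q ++_) (slice-c-gap ℓ (a≡suc-pred ℓ)) ⟨
    slice c 0 q ++ slice c q (suc d) ≡⟨ slice-++ c 0 q (suc d) ⟨
    slice c 0 (q + suc d)            ≡⟨ cong (slice c 0 ∘ pred) a-suc′ ⟨
    slice c 0 (pred (a (suc ℓ)))     ∎
    where
    open ≡-Reasoning
    q = pred (a ℓ)
    d = padding (c ℓ)
    a-suc′ : a (suc ℓ) ≡ suc q + suc d
    a-suc′ = trans (a-suc ℓ) (cong (_+ suc d) (a≡suc-pred ℓ))

  a-one : a 1 ≡ 3 + y″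
  a-one = trans (a-suc 0) (cong (λ b → 1 + suc (padding b)) (value⇒true isCharSeq {0} refl))

  ℓ<pred-a : ∀ {ℓ} → 1 ≤ ℓ → ℓ < pred (a ℓ)
  ℓ<pred-a {suc ℓ} _ = begin-strict
    suc ℓ                 <⟨ ≤-refl ⟩
    suc (suc ℓ)           ≤⟨ s≤s (s≤s (m≤n+m ℓ y″)) ⟩
    pred (3 + y″ + ℓ)     ≡⟨ cong (λ n → pred (n + ℓ)) a-one ⟨
    pred (a 1 + ℓ)        ≤⟨ pred-mono-≤ (+-≤ 1 ℓ) ⟩
    pred (a (suc ℓ))      ∎
    where open ≤-Reasoning

  purelyMorphic : PurelyMorphicSeq a
  purelyMorphic = c , isCharSeq , ψ , c 0 , c
                , isFixedPointFrom-expanding ψ c (pred ∘ a) (λ {ℓ} _ → extend-slice-c ℓ) ℓ<pred-a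
                , λ _ → refl

lemma7 : (x y z : ℕ) → 1 ≤ x → 1 ≤ y → 1 ≤ z → y ≢ z →
    MorphicSeq (hiccup x y z)
    × (x ≡ 1 → 1 < y → PurelyMorphicSeq (hiccup x y z))
lemma7 (suc x′) (suc y′) (suc z′) _ _ _ _ = Hiccup.morphic x′ y′ z′ , purely
  where
  purely : suc x′ ≡ 1 → 1 < suc y′ → PurelyMorphicSeq (hiccup (suc x′) (suc y′) (suc z′))
  purely refl (s≤s (s≤s {n = y″} _)) = HiccupFromOne.purelyMorphic y″ z′
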